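{- Let $n_1>n_2\ge1$ and $k_1,k_2\ge1$ be integers with $k_1n_1+k_2n_2=n$, $\gcd(n_1,n_2)=1$ and $\gcd(k_1,k_2)=1$. Then there exists a positive integer $r$ with $\gcd(r,n)=1$ such that $(n,r)\times[1,0]$ is an ancestor of $(n_1,n_2)\times[k_1,k_2]$ under the extended Farey map.
   Context: $(a_1,a_2)\times[c_1,c_2]$ denotes the partition of $c_1a_1+c_2a_2$ with $c_1$ parts $a_1$ and $c_2$ parts $a_2$. $\tilde F_0((a_1,a_2)\times[c_1,c_2])=(a_2,a_1-a_2)\times[c_1+c_2,c_1]$ and $\tilde F_1((a_1,a_2)\times[c_1,c_2])=(a_1-a_2,a_2)\times[c_1,c_1+c_2]$. The extended Farey map $\tilde F$ applies $\tilde F_0$ when $a_2\ge a_1-a_2$ and $\tilde F_1$ when $a_1-a_2\ge a_2$ (either when equal). $\lambda$ is an ancestor of $\mu$ if $\mu$ is obtained from $\lambda$ by finitely many applications of $\tilde F$. -}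

module Defs where

open import Data.Nat using (ℕ; _+_; _∸_; _≤_)
open import Data.Product using (_×_)
open import Relation.Binary.PropositionalEquality using (_≡_)
open import Relation.Binary.Construct.Closure.ReflexiveTransitive using (Star)

-- (a₁ , a₂) × [ c₁ , c₂ ] : the partition of c₁a₁ + c₂a₂ with c₁ parts a₁
-- and c₂ parts a₂, kept as its symbolic representation.
record BiPart : Set where
  constructor ⟨_,_⟩×[_,_]
  field
    a₁ a₂ c₁ c₂ : ℕ

open BiPart public

F₀ : BiPart → BiPart
F₀ ⟨ a₁ , a₂ ⟩×[ c₁ , c₂ ] = ⟨ a₂ , a₁ ∸ a₂ ⟩×[ c₁ + c₂ , c₁ ]

F₁ : BiPart → BiPart
F₁ ⟨ a₁ , a₂ ⟩×[ c₁ , c₂ ] = ⟨ a₁ ∸ a₂ , a₂ ⟩×[ c₁ , c₁ + c₂ ]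

-- One application of the extended Farey map F̃ (only where a₂ ≤ a₁, so that
-- a₁ - a₂ is the genuine difference). F̃₀ applies when a₂ ≥ a₁ - a₂,
-- F̃₁ when a₁ - a₂ ≥ a₂ (either one when equal).
data FareyStep : BiPart → BiPart → Set where
  step₀ : ∀ {p} → a₂ p ≤ a₁ p → a₁ p ∸ a₂ p ≤ a₂ p → FareyStep p (F₀ p)
  step₁ : ∀ {p} → a₂ p ≤ a₁ p → a₂ p ≤ a₁ p ∸ a₂ p → FareyStep p (F₁ p)

Ancestor : BiPart → BiPart → Set
Ancestor = Star FareyStep

-- Run the extended Farey map backwards.  The multiplicities (c₁, c₂) then
-- undergo the subtractive Euclidean algorithm, (c₂ + d, c₂) ↦ (c₂, d) or
-- (c₁, c₁ + d) ↦ (c₁, d), while the parts (a₁, a₂) grow to (a₁ + a₂, a₁) or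
-- (a₁ + a₂, a₂).  Both moves preserve coprimality of each pair, so starting
-- from gcd(k₁, k₂) = 1 the multiplicities reach [1, 0] with coprime parts
-- (m, r), r ≥ 1.  Every Farey step preserves the size c₁a₁ + c₂a₂, hence m = n.
module Submission where

open import Defs
open import Data.Nat using (ℕ; zero; suc; _+_; _*_; _<_; _≤_; z≤n; s≤s)
open import Data.Nat.Divisibility using (_∣_; ∣-antisym; ∣m∣n⇒∣m+n; ∣m+n∣m⇒∣n)
open import Data.Nat.GCD using (gcd; gcd-greatest; gcd[m,n]∣m; gcd[m,n]∣n; gcd-comm; gcd-identityʳ)
open import Data.Nat.Induction using (<-wellFounded)
open import Data.Nat.Properties
  using (+-comm; +-identityʳ; m+n∸m≡n; m+n∸n≡m; m≤m+n; m≤n+m; m<m+n; m<n+m; m≤n⇒∃[o]m+o≡n; _≤?_; ≰⇒>; <⇒≤; ≤-trans)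
open import Data.Nat.Tactic.RingSolver using (solve-∀)
open import Data.Product using (Σ; _×_; _,_)
open import Induction.WellFounded using (Acc; acc)
open import Relation.Binary.Construct.Closure.ReflexiveTransitive using (ε; _◅_; _◅◅_; fold)
open import Relation.Binary.PropositionalEquality using (_≡_; refl; sym; trans; subst)
open import Relation.Nullary using (yes; no)

gcd[m+n,n]≡gcd[m,n] : ∀ m n → gcd (m + n) n ≡ gcd m n
gcd[m+n,n]≡gcd[m,n] m n = ∣-antisym
  (gcd-greatest (∣m+n∣m⇒∣n (subst (gcd (m + n) n ∣_) (+-comm m n) (gcd[m,n]∣m (m + n) n))
                           (gcd[m,n]∣n (m + n) n))
                (gcd[m,n]∣n (m + n) n))
  (gcd-greatest (∣m∣n⇒∣m+n (gcd[m,n]∣m m n) (gcd[m,n]∣n m n)) (gcd[m,n]∣n m n))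

gcd[m+n,m]≡gcd[m,n] : ∀ m n → gcd (m + n) m ≡ gcd m n
gcd[m+n,m]≡gcd[m,n] m n rewrite +-comm m n | gcd[m+n,n]≡gcd[m,n] n m = gcd-comm n m

gcd[m,m+n]≡gcd[m,n] : ∀ m n → gcd m (m + n) ≡ gcd m n
gcd[m,m+n]≡gcd[m,n] m n = trans (gcd-comm m (m + n)) (gcd[m+n,m]≡gcd[m,n] m n)

size : BiPart → ℕ
size p = c₁ p * a₁ p + c₂ p * a₂ p

size-root : ∀ m r → size ⟨ m , r ⟩×[ 1 , 0 ] ≡ m
size-root m r = trans (+-identityʳ (m + 0)) (+-identityʳ m)

size-F₀ : ∀ a e c₁ c₂ → c₁ * (a + e) + c₂ * a ≡ (c₁ + c₂) * a + c₁ * e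
size-F₀ = solve-∀

size-F₁ : ∀ a e c₁ c₂ → c₁ * (a + e) + c₂ * a ≡ c₁ * e + (c₁ + c₂) * a
size-F₁ = solve-∀

FareyStep-size : ∀ {p q} → FareyStep p q → size p ≡ size q
FareyStep-size (step₀ {⟨ a₁ , a₂ ⟩×[ c₁ , c₂ ]} a₂≤a₁ _)
  with e , refl ← m≤n⇒∃[o]m+o≡n a₂≤a₁ rewrite m+n∸m≡n a₂ e = size-F₀ a₂ e c₁ c₂
FareyStep-size (step₁ {⟨ a₁ , a₂ ⟩×[ c₁ , c₂ ]} a₂≤a₁ _)
  with e , refl ← m≤n⇒∃[o]m+o≡n a₂≤a₁ rewrite m+n∸m≡n a₂ e = size-F₁ a₂ e c₁ c₂

Ancestor-size : ∀ {p q} → Ancestor p q → size p ≡ size q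
Ancestor-size = fold (λ p q → size p ≡ size q) (λ s e → trans (FareyStep-size s) e) refl

F₀-predecessor : ∀ {a₁ a₂} c d → a₂ ≤ a₁ →
  FareyStep ⟨ a₁ + a₂ , a₁ ⟩×[ c , d ] ⟨ a₁ , a₂ ⟩×[ c + d , c ]
F₀-predecessor {a₁} {a₂} c d a₂≤a₁ =
  subst (λ x → FareyStep ⟨ a₁ + a₂ , a₁ ⟩×[ c , d ] ⟨ a₁ , x ⟩×[ c + d , c ]) (m+n∸m≡n a₁ a₂)
    (step₀ (m≤m+n a₁ a₂) (subst (_≤ a₁) (sym (m+n∸m≡n a₁ a₂)) a₂≤a₁))

F₁-predecessor : ∀ {a₁ a₂} c d → a₂ ≤ a₁ →
  FareyStep ⟨ a₁ + a₂ , a₂ ⟩×[ c , d ] ⟨ a₁ , a₂ ⟩×[ c , c + d ]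
F₁-predecessor {a₁} {a₂} c d a₂≤a₁ =
  subst (λ x → FareyStep ⟨ a₁ + a₂ , a₂ ⟩×[ c , d ] ⟨ x , a₂ ⟩×[ c , c + d ]) (m+n∸n≡m a₁ a₂)
    (step₁ (m≤n+m a₂ a₁) (subst (a₂ ≤_) (sym (m+n∸n≡m a₁ a₂)) a₂≤a₁))

HasCoprimeRoot : BiPart → Set
HasCoprimeRoot p = Σ ℕ λ m → Σ ℕ λ r → (1 ≤ r) × (gcd r m ≡ 1) × Ancestor ⟨ m , r ⟩×[ 1 , 0 ] p

HasCoprimeRoot-step : ∀ {p q} → HasCoprimeRoot p → FareyStep p q → HasCoprimeRoot q
HasCoprimeRoot-step (m , r , r≥1 , coprime , anc) s = m , r , r≥1 , coprime , anc ◅◅ (s ◅ ε)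

hasCoprimeRoot : ∀ {a₁ a₂ c₁ c₂} → a₂ ≤ a₁ → 1 ≤ a₂ → 1 ≤ c₁ →
  gcd a₁ a₂ ≡ 1 → gcd c₁ c₂ ≡ 1 → HasCoprimeRoot ⟨ a₁ , a₂ ⟩×[ c₁ , c₂ ]
hasCoprimeRoot {c₁ = c₁} {c₂} = rooted (<-wellFounded (c₁ + c₂))
  where
  rooted : ∀ {a₁ a₂ c₁ c₂} → Acc _<_ (c₁ + c₂) → a₂ ≤ a₁ → 1 ≤ a₂ → 1 ≤ c₁ →
    gcd a₁ a₂ ≡ 1 → gcd c₁ c₂ ≡ 1 → HasCoprimeRoot ⟨ a₁ , a₂ ⟩×[ c₁ , c₂ ]
  descend : ∀ {a₁ a₂ c₁ c₂} → 1 ≤ c₂ → Acc _<_ (c₁ + c₂) → a₂ ≤ a₁ → 1 ≤ a₂ → 1 ≤ c₁ →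
    gcd a₁ a₂ ≡ 1 → gcd c₁ c₂ ≡ 1 → HasCoprimeRoot ⟨ a₁ , a₂ ⟩×[ c₁ , c₂ ]

  rooted {a₁} {a₂} {c₁} {zero} _ _ a₂≥1 _ ga gc rewrite trans (sym (gcd-identityʳ c₁)) gc =
    a₁ , a₂ , a₂≥1 , trans (gcd-comm a₂ a₁) ga , ε
  rooted {c₂ = suc _} = descend (s≤s z≤n)

  descend {a₁} {a₂} {c₁} {c₂} c₂≥1 (acc rec) a₂≤a₁ a₂≥1 c₁≥1 ga gc with c₂ ≤? c₁
  ... | yes c₂≤c₁ with d , refl ← m≤n⇒∃[o]m+o≡n c₂≤c₁ = HasCoprimeRoot-step
    (rooted (rec (m<m+n (c₂ + d) c₂≥1)) (m≤m+n a₁ a₂) (≤-trans a₂≥1 a₂≤a₁) c₂≥1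
      (trans (gcd[m+n,m]≡gcd[m,n] a₁ a₂) ga) (trans (sym (gcd[m+n,m]≡gcd[m,n] c₂ d)) gc))
    (F₀-predecessor c₂ d a₂≤a₁)
  ... | no c₂≰c₁ with d , refl ← m≤n⇒∃[o]m+o≡n (<⇒≤ (≰⇒> c₂≰c₁)) = HasCoprimeRoot-step
    (rooted (rec (m<n+m (c₁ + d) c₁≥1)) (m≤n+m a₂ a₁) a₂≥1 c₁≥1
      (trans (gcd[m+n,n]≡gcd[m,n] a₁ a₂) ga) (trans (sym (gcd[m,m+n]≡gcd[m,n] c₁ d)) gc))
    (F₁-predecessor c₁ d a₂≤a₁)

theorem4p18 : (n n₁ n₂ k₁ k₂ : ℕ) →
    n₂ < n₁ → 1 ≤ n₂ → 1 ≤ k₁ → 1 ≤ k₂ →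
    k₁ * n₁ + k₂ * n₂ ≡ n →
    gcd n₁ n₂ ≡ 1 → gcd k₁ k₂ ≡ 1 →
    Σ ℕ (λ r → (1 ≤ r) × (gcd r n ≡ 1) ×
      Ancestor ⟨ n , r ⟩×[ 1 , 0 ] ⟨ n₁ , n₂ ⟩×[ k₁ , k₂ ])
theorem4p18 _ n₁ n₂ k₁ k₂ n₂<n₁ n₂≥1 k₁≥1 _ refl gn gk
  with m , r , r≥1 , coprime , anc ← hasCoprimeRoot (<⇒≤ n₂<n₁) n₂≥1 k₁≥1 gn gk
  with refl ← trans (sym (size-root m r)) (Ancestor-size anc)
  = r , r≥1 , coprime , anc
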